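{- For all integers $n\ge 2$, $$G_{n}^{(s)}(m,r,s)=f(rs^{n})\,G_{n-1}^{(s)}(m,r,s)+rs^{n}\,G_{n-2}^{(s)}(m,r,s),$$ where $f(x)=1+x(m-1)$.
   Context: For an integer $n\ge0$ and a subset $S\subseteq\{1,\dots,n\}$ (the positions of dimers on a segment with vertices $0,1,\dots,n$, a dimer at position $i$ being the edge $\{i-1,i\}$), let $|S|$ be its size, $\sigma(S)=\sum_{i\in S}i$, and $c(S)$ the number of maximal runs of consecutive integers in $S$. Define the polynomial $$G_n^{(s)}(m,r,s)=\sum_{S\subseteq\{1,\dots,n\}} s^{\sigma(S)}r^{|S|}m^{c(S)}(m-1)^{|S|-c(S)}\in\mathbb{Z}[m,r,s],$$ so $G_0^{(s)}=1$. (For a positive integer $m$ this is the generating function of dimer configurations where each dimer has one of $m$ colors and dimers at adjacent positions have different colors, weighted by $r^{\#\text{dimers}}s^{\text{sum of positions}}$.) -}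

module Defs where

open import Level using (Level)
open import Algebra.Bundles using (CommutativeRing)
open import Data.Bool using (Bool; true; false)
open import Data.Nat using (ℕ; zero; suc; _∸_) renaming (_+_ to _+ℕ_)
open import Data.List using (List; []; _∷_; map; _++_; foldr)
open import Data.Vec using (Vec; []; _∷_; toList)

-- All subsets of {1,…,n}, encoded as characteristic vectors:
-- entry k (0-based) of the vector is true iff position k+1 is in S.
allSubsets : (n : ℕ) → List (Vec Bool n)
allSubsets zero = [] ∷ []
allSubsets (suc n) = map (false ∷_) (allSubsets n) ++ map (true ∷_) (allSubsets n)

size : List Bool → ℕ
size [] = 0
size (true ∷ bs) = suc (size bs)
size (false ∷ bs) = size bs

sigmaFrom : ℕ → List Bool → ℕ
sigmaFrom p [] = 0
sigmaFrom p (true ∷ bs) = p +ℕ sigmaFrom (suc p) bs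
sigmaFrom p (false ∷ bs) = sigmaFrom (suc p) bs

-- number of maximal runs: elements of S whose predecessor is not in S;
-- the flag says whether the previous position is in S
runsFrom : Bool → List Bool → ℕ
runsFrom prev [] = 0
runsFrom false (true ∷ bs) = suc (runsFrom true bs)
runsFrom true (true ∷ bs) = runsFrom true bs
runsFrom _ (false ∷ bs) = runsFrom false bs

module _ {c ℓ : Level} (R : CommutativeRing c ℓ) where
  open CommutativeRing R

  pow : Carrier → ℕ → Carrier
  pow x zero = 1#
  pow x (suc k) = x * pow x k

  weight : Carrier → Carrier → Carrier → List Bool → Carrier
  weight m r s bs =
    pow s (sigmaFrom 1 bs) * pow r (size bs) * pow m (runsFrom false bs)
      * pow (m - 1#) (size bs ∸ runsFrom false bs)

  G : Carrier → Carrier → Carrier → ℕ → Carrier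
  G m r s n = foldr _+_ 0# (map (λ S → weight m r s (toList S)) (allSubsets n))

  f : Carrier → Carrier → Carrier
  f m x = 1# + x * (m - 1#)

-- A dimer at position p contributes s^p r times a colour factor: m if position p − 1 is empty
-- (it starts a new run) and m − 1 otherwise, so the weight of a configuration is a product over
-- its positions. Summing over the status of the first position then writes the sum over positions
-- p, …, p + n as a combination of two such sums starting at p + 1, with coefficients independent
-- of n. Induction on n along this first-position decomposition turns the two-term recurrence for
-- the sums starting at p + 1 into the one for the sums starting at p, which is the theorem
-- at p = 1 (the recurrence removes the last position).
module Submission where

open import Defs
open import Level using (Level)
open import Algebra.Bundles using (CommutativeRing)
open import Data.Bool using (Bool; true; false)
open import Data.List using (List; []; _∷_; map; _++_; foldr)
open import Data.Maybe using (nothing)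
open import Data.Nat using (ℕ; zero; suc; _∸_; _≤_; z≤n; s≤s) renaming (_+_ to _+ℕ_)
import Data.Nat.Properties as ℕ
open import Data.Vec using (Vec; _∷_; toList)
open import Relation.Binary.PropositionalEquality using (_≡_; cong) renaming (sym to ≡-sym)
import Relation.Binary.Reasoning.Setoid as SetoidReasoning

runsFrom≤size : ∀ b bs → runsFrom b bs ≤ size bs
runsFrom≤size b [] = z≤n
runsFrom≤size false (true ∷ bs) = s≤s (runsFrom≤size true bs)
runsFrom≤size true (true ∷ bs) = ℕ.m≤n⇒m≤1+n (runsFrom≤size true bs)
runsFrom≤size false (false ∷ bs) = runsFrom≤size false bs
runsFrom≤size true (false ∷ bs) = runsFrom≤size false bs

module Dimers {c ℓ : Level} (R : CommutativeRing c ℓ) where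
  open CommutativeRing R
  open SetoidReasoning setoid
  open import Algebra.Solver.Ring.NaturalCoefficients commutativeSemiring (λ _ _ → nothing)
    using (solve; _:=_; _:+_; _:*_; con)

  pow-+ : ∀ x a b → pow R x (a +ℕ b) ≈ pow R x a * pow R x b
  pow-+ x zero b = sym (*-identityˡ _)
  pow-+ x (suc a) b = trans (*-congˡ (pow-+ x a b)) (sym (*-assoc _ _ _))

  pow-cong : ∀ x {a b} → a ≡ b → pow R x a ≈ pow R x b
  pow-cong x a≡b = reflexive (cong (pow R x) a≡b)

  x≈x-1+1 : ∀ x → x ≈ (x - 1#) + 1#
  x≈x-1+1 x = sym (begin
    x - 1# + 1#      ≈⟨ +-assoc x (- 1#) 1# ⟩
    x + (- 1# + 1#)  ≈⟨ +-congˡ (-‿inverseˡ 1#) ⟩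
    x + 0#           ≈⟨ +-identityʳ x ⟩
    x                ∎)

  sumMap : {A : Set} → (A → Carrier) → List A → Carrier
  sumMap g xs = foldr _+_ 0# (map g xs)

  sumMap-++ : {A : Set} (g : A → Carrier) (xs ys : List A) →
              sumMap g (xs ++ ys) ≈ sumMap g xs + sumMap g ys
  sumMap-++ g [] ys = sym (+-identityˡ _)
  sumMap-++ g (x ∷ xs) ys = trans (+-congˡ (sumMap-++ g xs ys)) (sym (+-assoc _ _ _))

  sumMap-map : {A B : Set} (g : B → Carrier) (h : A → B) (xs : List A) →
               sumMap g (map h xs) ≈ sumMap (λ a → g (h a)) xs
  sumMap-map g h [] = refl
  sumMap-map g h (x ∷ xs) = +-congˡ (sumMap-map g h xs)

  sumMap-cong : {A : Set} {g g′ : A → Carrier} → (∀ a → g a ≈ g′ a) →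
                (xs : List A) → sumMap g xs ≈ sumMap g′ xs
  sumMap-cong g≈g′ [] = refl
  sumMap-cong g≈g′ (x ∷ xs) = +-cong (g≈g′ x) (sumMap-cong g≈g′ xs)

  sumMap-*ˡ : {A : Set} (k : Carrier) (g : A → Carrier) (xs : List A) →
              sumMap (λ a → k * g a) xs ≈ k * sumMap g xs
  sumMap-*ˡ k g [] = sym (zeroʳ k)
  sumMap-*ˡ k g (x ∷ xs) = trans (+-congˡ (sumMap-*ˡ k g xs)) (sym (distribˡ k _ _))

  module _ (m r s : Carrier) where

    -- The flag says whether the position before the current one holds a dimer.
    colourFactor : Bool → Carrier
    colourFactor false = m
    colourFactor true = m - 1#

    weightFrom : Bool → ℕ → List Bool → Carrier
    weightFrom b p [] = 1#
    weightFrom b p (false ∷ bs) = weightFrom false (suc p) bs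
    weightFrom b p (true ∷ bs) = pow R s p * r * colourFactor b * weightFrom true (suc p) bs

    closedWeightFrom : Bool → ℕ → List Bool → Carrier
    closedWeightFrom b p bs =
      pow R s (sigmaFrom p bs) * pow R r (size bs) * pow R m (runsFrom b bs)
        * pow R (m - 1#) (size bs ∸ runsFrom b bs)

    closedWeightFrom≈weightFrom : ∀ b p bs → closedWeightFrom b p bs ≈ weightFrom b p bs
    closedWeightFrom≈weightFrom b p [] = trans (*-identityʳ _) (trans (*-identityʳ _) (*-identityʳ _))
    closedWeightFrom≈weightFrom false p (false ∷ bs) = closedWeightFrom≈weightFrom false (suc p) bs
    closedWeightFrom≈weightFrom true p (false ∷ bs) = closedWeightFrom≈weightFrom false (suc p) bs
    closedWeightFrom≈weightFrom false p (true ∷ bs) = begin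
      pow R s (p +ℕ σ) * (r * pow R r k) * (m * pow R m c′) * pow R (m - 1#) (k ∸ c′)
        ≈⟨ *-congʳ (*-congʳ (*-congʳ (pow-+ s p σ))) ⟩
      pow R s p * pow R s σ * (r * pow R r k) * (m * pow R m c′) * pow R (m - 1#) (k ∸ c′)
        ≈⟨ solve 7 (λ a b x y z u v → a :* b :* (x :* y) :* (z :* u) :* v
                                      := a :* x :* z :* (b :* y :* u :* v)) refl
             (pow R s p) (pow R s σ) r (pow R r k) m (pow R m c′) (pow R (m - 1#) (k ∸ c′)) ⟩
      pow R s p * r * m * closedWeightFrom true (suc p) bs
        ≈⟨ *-congˡ (closedWeightFrom≈weightFrom true (suc p) bs) ⟩
      pow R s p * r * m * weightFrom true (suc p) bs ∎
      where σ = sigmaFrom (suc p) bs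
            k = size bs
            c′ = runsFrom true bs
    closedWeightFrom≈weightFrom true p (true ∷ bs) = begin
      pow R s (p +ℕ σ) * (r * pow R r k) * pow R m c′ * pow R (m - 1#) (suc k ∸ c′)
        ≈⟨ *-cong (*-congʳ (*-congʳ (pow-+ s p σ)))
                  (pow-cong (m - 1#) (ℕ.+-∸-assoc 1 (runsFrom≤size true bs))) ⟩
      pow R s p * pow R s σ * (r * pow R r k) * pow R m c′ * ((m - 1#) * pow R (m - 1#) (k ∸ c′))
        ≈⟨ solve 7 (λ a b x y u z v → a :* b :* (x :* y) :* u :* (z :* v)
                                      := a :* x :* z :* (b :* y :* u :* v)) refl
             (pow R s p) (pow R s σ) r (pow R r k) (pow R m c′) (m - 1#) (pow R (m - 1#) (k ∸ c′)) ⟩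
      pow R s p * r * (m - 1#) * closedWeightFrom true (suc p) bs
        ≈⟨ *-congˡ (closedWeightFrom≈weightFrom true (suc p) bs) ⟩
      pow R s p * r * (m - 1#) * weightFrom true (suc p) bs ∎
      where σ = sigmaFrom (suc p) bs
            k = size bs
            c′ = runsFrom true bs

    Gfrom : Bool → ℕ → ℕ → Carrier
    Gfrom b p n = sumMap (λ S → weightFrom b p (toList S)) (allSubsets n)

    G≈Gfrom : ∀ n → G R m r s n ≈ Gfrom false 1 n
    G≈Gfrom n = sumMap-cong (λ S → closedWeightFrom≈weightFrom false 1 (toList S)) (allSubsets n)

    Gfrom-zero : ∀ b p → Gfrom b p 0 ≈ 1#
    Gfrom-zero b p = +-identityʳ 1#

    Gfrom-suc : ∀ b p n →
                Gfrom b p (suc n)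
                  ≈ Gfrom false (suc p) n + pow R s p * r * colourFactor b * Gfrom true (suc p) n
    Gfrom-suc b p n = begin
      sumMap g (map (false ∷_) L ++ map (true ∷_) L)
        ≈⟨ sumMap-++ g (map (false ∷_) L) (map (true ∷_) L) ⟩
      sumMap g (map (false ∷_) L) + sumMap g (map (true ∷_) L)
        ≈⟨ +-cong (sumMap-map g (false ∷_) L) (sumMap-map g (true ∷_) L) ⟩
      Gfrom false (suc p) n + sumMap (λ S → k * weightFrom true (suc p) (toList S)) L
        ≈⟨ +-congˡ (sumMap-*ˡ k (λ S → weightFrom true (suc p) (toList S)) L) ⟩
      Gfrom false (suc p) n + k * Gfrom true (suc p) n ∎
      where L = allSubsets n
            k = pow R s p * r * colourFactor b
            g : Vec Bool (suc n) → Carrier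
            g S = weightFrom b p (toList S)

    Gfrom-one : ∀ b p → Gfrom b p 1 ≈ 1# + pow R s p * r * colourFactor b
    Gfrom-one b p = trans (Gfrom-suc b p 0)
      (+-cong (Gfrom-zero false (suc p)) (trans (*-congˡ (Gfrom-zero true (suc p))) (*-identityʳ _)))

    Gfrom-two : ∀ b p →
                Gfrom b p 2 ≈ f R m (r * pow R s (suc p)) * Gfrom b p 1 + r * pow R s (suc p) * Gfrom b p 0
    Gfrom-two b p = begin
      Gfrom b p 2
        ≈⟨ Gfrom-suc b p 1 ⟩
      Gfrom false (suc p) 1 + y * r * c′ * Gfrom true (suc p) 1
        ≈⟨ +-cong (Gfrom-one false (suc p)) (*-congˡ (Gfrom-one true (suc p))) ⟩
      (1# + t * r * m) + y * r * c′ * (1# + t * r * m₁)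
        ≈⟨ +-congʳ (+-congˡ (*-congˡ (x≈x-1+1 m))) ⟩
      (1# + t * r * (m₁ + 1#)) + y * r * c′ * (1# + t * r * m₁)
        ≈⟨ solve 5 (λ t r m₁ y c′ →
             (con 1 :+ t :* r :* (m₁ :+ con 1)) :+ y :* r :* c′ :* (con 1 :+ t :* r :* m₁)
             := (con 1 :+ r :* t :* m₁) :* (con 1 :+ y :* r :* c′) :+ r :* t :* con 1) refl t r m₁ y c′ ⟩
      (1# + r * t * m₁) * (1# + y * r * c′) + r * t * 1#
        ≈˘⟨ +-cong (*-congˡ (Gfrom-one b p)) (*-congˡ (Gfrom-zero b p)) ⟩
      f R m (r * t) * Gfrom b p 1 + r * t * Gfrom b p 0 ∎
      where y = pow R s p
            t = pow R s (suc p)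
            m₁ = m - 1#
            c′ = colourFactor b

    Gfrom-recurrence : ∀ n b p →
      Gfrom b p (suc (suc n))
        ≈ f R m (r * pow R s (p +ℕ suc n)) * Gfrom b p (suc n) + r * pow R s (p +ℕ suc n) * Gfrom b p n
    Gfrom-recurrence zero b p = begin
      Gfrom b p 2
        ≈⟨ Gfrom-two b p ⟩
      f R m (r * pow R s (suc p)) * Gfrom b p 1 + r * pow R s (suc p) * Gfrom b p 0
        ≈˘⟨ +-cong (*-congʳ (+-congˡ (*-congʳ x≈))) (*-congʳ x≈) ⟩
      f R m (r * pow R s (p +ℕ 1)) * Gfrom b p 1 + r * pow R s (p +ℕ 1) * Gfrom b p 0 ∎
      where x≈ : r * pow R s (p +ℕ 1) ≈ r * pow R s (suc p)
            x≈ = *-congˡ (pow-cong s (ℕ.+-comm p 1))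
    Gfrom-recurrence (suc n) b p = begin
      Gfrom b p (3 +ℕ n)
        ≈⟨ Gfrom-suc b p (2 +ℕ n) ⟩
      Gfrom false (suc p) (2 +ℕ n) + k * Gfrom true (suc p) (2 +ℕ n)
        ≈⟨ +-cong (shifted false) (*-congˡ (shifted true)) ⟩
      (F * a₁ + X * a₀) + k * (F * b₁ + X * b₀)
        ≈⟨ solve 7 (λ F X k a₁ a₀ b₁ b₀ →
             (F :* a₁ :+ X :* a₀) :+ k :* (F :* b₁ :+ X :* b₀)
             := F :* (a₁ :+ k :* b₁) :+ X :* (a₀ :+ k :* b₀)) refl F X k a₁ a₀ b₁ b₀ ⟩
      F * (a₁ + k * b₁) + X * (a₀ + k * b₀)
        ≈˘⟨ +-cong (*-congˡ (Gfrom-suc b p (suc n))) (*-congˡ (Gfrom-suc b p n)) ⟩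
      F * Gfrom b p (2 +ℕ n) + X * Gfrom b p (suc n) ∎
      where k = pow R s p * r * colourFactor b
            X = r * pow R s (p +ℕ suc (suc n))
            F = f R m X
            a₁ = Gfrom false (suc p) (suc n)
            a₀ = Gfrom false (suc p) n
            b₁ = Gfrom true (suc p) (suc n)
            b₀ = Gfrom true (suc p) n
            X≈ : r * pow R s (suc p +ℕ suc n) ≈ X
            X≈ = *-congˡ (pow-cong s (≡-sym (ℕ.+-suc p (suc n))))
            shifted : ∀ b′ → Gfrom b′ (suc p) (2 +ℕ n)
                               ≈ F * Gfrom b′ (suc p) (suc n) + X * Gfrom b′ (suc p) n
            shifted b′ = trans (Gfrom-recurrence n b′ (suc p))
                               (+-cong (*-congʳ (+-congˡ (*-congʳ X≈))) (*-congʳ X≈))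

mainTheorem3 : {c ℓ : Level} (R : CommutativeRing c ℓ) →
    let open CommutativeRing R in
    (m r s : Carrier) (n : ℕ) →
    G R m r s (suc (suc n))
      ≈ f R m (r * pow R s (suc (suc n))) * G R m r s (suc n)
        + r * pow R s (suc (suc n)) * G R m r s n
mainTheorem3 R m r s n = begin
  G R m r s (suc (suc n))
    ≈⟨ G≈Gfrom m r s (suc (suc n)) ⟩
  Gfrom m r s false 1 (suc (suc n))
    ≈⟨ Gfrom-recurrence m r s n false 1 ⟩
  f R m X * Gfrom m r s false 1 (suc n) + X * Gfrom m r s false 1 n
    ≈˘⟨ +-cong (*-congˡ (G≈Gfrom m r s (suc n))) (*-congˡ (G≈Gfrom m r s n)) ⟩
  f R m X * G R m r s (suc n) + X * G R m r s n ∎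
  where open CommutativeRing R
        open Dimers R
        open SetoidReasoning setoid
        X = r * pow R s (suc (suc n))
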